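{- Let $\Phi,\Gamma,\Delta\in W^c_{\vdash_{\mathbf{SU}}}$ with $\Phi\subseteq\Gamma\cap\Delta$, and let $\Theta=\Phi\cup\{\neg\alpha\to\beta:\alpha\in\Gamma,\beta\in\Delta\}\cup\{\neg\beta\to\alpha:\beta\in\Delta,\alpha\in\Gamma\}$. Then the subtree of the $\Theta$-disjunction tree consisting of the 01-sequences $\bar s$ with $\Theta_{\bar s}\subseteq\Gamma\cap\Delta$ has an infinite branch, i.e. there is an infinite 01-sequence all of whose finite initial segments $\bar s$ satisfy $\Theta_{\bar s}\subseteq\Gamma\cap\Delta$.
   Context: Formulas are built from countably many propositional variables and $\bot$ with $\land,\lor,\to$; $\neg\alpha$ abbreviates $\alpha\to\bot$, $\top$ abbreviates $\bot\to\bot$. $\vdash_{\mathbf{SU}}$ is the consequence relation of a Hilbert system for intuitionistic propositional logic (with modus ponens) extended by all substitution instances of $\boldsymbol{su} = ((\neg p\to q)\land(\neg q\to p) \rightarrow r \vee s) \to ( p \rightarrow r) \vee(q \rightarrow s)$ as axioms. $W^c_{\vdash_{\mathbf{SU}}}$ is the set of all sets of formulas that are $\vdash_{\mathbf{SU}}$-consistent, $\vdash_{\mathbf{SU}}$-closed and disjunction complete. Fix an enumeration $\Xi$ of all formulas of the form $\phi\lor\psi$. For a set $\Theta$, the $\Theta$-disjunction tree assigns to each finite 01-sequence $\bar s$ a formula $\alpha_{\bar s}$, a set $\Theta_{\bar s}$ and a sequence $\Xi_{\bar s}$: $\alpha_\emptyset=\top$, $\Theta_\emptyset=\Theta$, $\Xi_\emptyset=\Xi$;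 given $\bar s$, let $\alpha_{\bar s0}\lor\alpha_{\bar s1}$ be the first formula in $\Xi_{\bar s}$ derivable from $\Theta_{\bar s}$, set $\Theta_{\bar s0}=\Theta_{\bar s}\cup\{\alpha_{\bar s0}\}$, $\Theta_{\bar s1}=\Theta_{\bar s}\cup\{\alpha_{\bar s1}\}$, and $\Xi_{\bar s0}=\Xi_{\bar s1}$ is $\Xi_{\bar s}$ with that formula removed. -}

module Defs where

open import Data.Nat using (ℕ; zero; suc; _<_)
open import Data.Bool using (Bool; true; false)
open import Data.List using (List; []; _∷ʳ_)
open import Data.Product using (Σ; _×_; _,_; uncurry)
open import Data.Sum using (_⊎_)
open import Data.Unit using (⊤)
open import Relation.Nullary using (¬_)
open import Relation.Binary.PropositionalEquality using (_≡_; _≢_)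

infixr 6 _∧_
infixr 5 _∨_
infixr 4 _⇒_

data Formula : Set where
  var  : ℕ → Formula
  ⊥f   : Formula
  _∧_  : Formula → Formula → Formula
  _∨_  : Formula → Formula → Formula
  _⇒_  : Formula → Formula → Formula

~_ : Formula → Formula
~ a = a ⇒ ⊥f

⊤f : Formula
⊤f = ⊥f ⇒ ⊥f

FSet : Set₁
FSet = Formula → Set

_⊆_ : FSet → FSet → Set
A ⊆ B = ∀ φ → A φ → B φ

_∩_ : FSet → FSet → FSet
(A ∩ B) φ = A φ × B φ

_∪｛_｝ : FSet → Formula → FSet
(A ∪｛ a ｝) φ = A φ ⊎ φ ≡ a

su : Formula → Formula → Formula → Formula → Formula
su p q r s = (((~ p ⇒ q) ∧ (~ q ⇒ p)) ⇒ (r ∨ s)) ⇒ ((p ⇒ r) ∨ (q ⇒ s))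

data _⊢_ (Θ : FSet) : Formula → Set where
  hyp  : ∀ {φ} → Θ φ → Θ ⊢ φ
  axK  : ∀ a b → Θ ⊢ (a ⇒ b ⇒ a)
  axS  : ∀ a b c → Θ ⊢ ((a ⇒ b ⇒ c) ⇒ (a ⇒ b) ⇒ a ⇒ c)
  ax∧I : ∀ a b → Θ ⊢ (a ⇒ b ⇒ a ∧ b)
  ax∧E₁ : ∀ a b → Θ ⊢ (a ∧ b ⇒ a)
  ax∧E₂ : ∀ a b → Θ ⊢ (a ∧ b ⇒ b)
  ax∨I₁ : ∀ a b → Θ ⊢ (a ⇒ a ∨ b)
  ax∨I₂ : ∀ a b → Θ ⊢ (b ⇒ a ∨ b)
  ax∨E : ∀ a b c → Θ ⊢ ((a ⇒ c) ⇒ (b ⇒ c) ⇒ (a ∨ b ⇒ c))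
  ax⊥  : ∀ a → Θ ⊢ (⊥f ⇒ a)
  axSU : ∀ p q r s → Θ ⊢ su p q r s
  mp   : ∀ {a b} → Θ ⊢ (a ⇒ b) → Θ ⊢ a → Θ ⊢ b

Consistent : FSet → Set
Consistent Θ = ¬ (Θ ⊢ ⊥f)

Closed : FSet → Set
Closed Θ = ∀ φ → Θ ⊢ φ → Θ φ

DisjComplete : FSet → Set
DisjComplete Θ = ∀ φ ψ → Θ (φ ∨ ψ) → Θ φ ⊎ Θ ψ

InW : FSet → Set
InW Θ = Consistent Θ × Closed Θ × DisjComplete Θ

ThetaSet : FSet → FSet → FSet → FSet
ThetaSet Φ Γ Δ φ =
  Φ φ
  ⊎ Σ Formula (λ α → Σ Formula (λ β → Γ α × Δ β × φ ≡ (~ α ⇒ β)))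
  ⊎ Σ Formula (λ β → Σ Formula (λ α → Δ β × Γ α × φ ≡ (~ β ⇒ α)))

-- Enumeration Ξ of all formulas φ∨ψ: ξ n = (φ , ψ) stands for φ∨ψ.
Disj : (ℕ → Formula × Formula) → ℕ → Formula
Disj ξ n = uncurry _∨_ (ξ n)

-- Data at a node of the disjunction tree: α_s, Θ_s, and Ξ_s, the latter
-- represented as the set of indices of Ξ still present (Ξ_s is Ξ restricted
-- to these indices, in the original order).
record NodeData : Set₁ where
  constructor node
  field
    α   : Formula
    Th  : FSet
    Av  : ℕ → Set
open NodeData public

Bsel : Bool → Formula → Formula → Formula
Bsel false x y = x
Bsel true  x y = y

-- Node ξ Θ s d : d is the data assigned to the 01-sequence s in the
-- Θ-disjunction tree (sequences are extended at the end with ∷ʳ).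
data Node (ξ : ℕ → Formula × Formula) (Θ : FSet) : List Bool → NodeData → Set₁ where
  root : Node ξ Θ [] (node ⊤f Θ (λ _ → ⊤))
  step : ∀ {s a Th Av} (n : ℕ) {a₀ a₁ : Formula} →
         Node ξ Θ s (node a Th Av) →
         Av n →
         Th ⊢ Disj ξ n →
         (∀ m → m < n → Av m → ¬ (Th ⊢ Disj ξ m)) →
         ξ n ≡ (a₀ , a₁) →
         (b : Bool) →
         Node ξ Θ (s ∷ʳ b)
           (node (Bsel b a₀ a₁) (Th ∪｛ Bsel b a₀ a₁ ｝) (λ m → Av m × m ≢ n))

prefix : (ℕ → Bool) → ℕ → List Bool
prefix f zero    = []
prefix f (suc n) = prefix f n ∷ʳ f n

{-# OPTIONS --safe #-}
-- Every derivation from Θ can be traced back to a derivation from Φ of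
-- (¬α → β) ∧ (¬β → α) → φ with α ∈ Γ and β ∈ Δ.  So if Θ ⊢ r ∨ s, the axiom su
-- and disjunction completeness of Φ give r ∈ Γ or s ∈ Δ: Θ splits into Γ, Δ,
-- and a set that splits lies inside Γ ∩ Δ.  If T splits and T ⊢ α₀ ∨ α₁, one of
-- T ∪ {α₀}, T ∪ {α₁} splits again: counterexamples r ∨ s and r' ∨ s' for both
-- would give T ⊢ (r ∨ r') ∨ (s ∨ s'), contradicting disjunction completeness of
-- Γ and Δ.  Every node has children, since all but finitely many entries of Ξ
-- remain and ⊤ ∨ p is derivable for every variable p; always moving to a
-- splitting child gives the branch.
module Submission where

open import Defs
open import Level using (0ℓ)
open import Axiom.ExcludedMiddle using (ExcludedMiddle)
open import Axiom.DoubleNegationElimination using (em⇒dne)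
open import Data.Nat using (ℕ; zero; suc; _≤_; _<_; _⊔_)
open import Data.Nat.Properties
  using (<-irrefl; ≮⇒≥; n<1+n; ≤-trans; m<1+n⇒m<n∨m≡n; m≤m⊔n; m≤n⊔m; m<n⇒m<n⊔o; m<n⇒m<o⊔n)
open import Data.Bool using (Bool; true; false)
open import Data.List using (List; []; _∷ʳ_)
open import Data.Product using (Σ; _×_; _,_; proj₁; proj₂; curry; uncurry)
open import Data.Sum using (_⊎_; inj₁; inj₂; [_,_])
open import Data.Unit using (tt)
open import Data.Empty using (⊥-elim)
open import Relation.Nullary using (¬_; yes; no)
open import Relation.Unary using (Pred; Decidable)
open import Function using (_∘_)
open import Function.Definitions using (Bijective; Surjective)
open import Relation.Binary.PropositionalEquality using (_≡_; _≢_; refl; sym; cong; subst)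

private
  variable
    T U : FSet
    a b c a₀ a₁ r s : Formula

⊢-mono : T ⊆ U → T ⊢ a → U ⊢ a
⊢-mono T⊆U (hyp x)        = hyp (T⊆U _ x)
⊢-mono T⊆U (axK a b)      = axK a b
⊢-mono T⊆U (axS a b c)    = axS a b c
⊢-mono T⊆U (ax∧I a b)     = ax∧I a b
⊢-mono T⊆U (ax∧E₁ a b)    = ax∧E₁ a b
⊢-mono T⊆U (ax∧E₂ a b)    = ax∧E₂ a b
⊢-mono T⊆U (ax∨I₁ a b)    = ax∨I₁ a b
⊢-mono T⊆U (ax∨I₂ a b)    = ax∨I₂ a b
⊢-mono T⊆U (ax∨E a b c)   = ax∨E a b c
⊢-mono T⊆U (ax⊥ a)        = ax⊥ a
⊢-mono T⊆U (axSU p q r s) = axSU p q r s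
⊢-mono T⊆U (mp d e)       = mp (⊢-mono T⊆U d) (⊢-mono T⊆U e)

weaken : T ⊢ a → (T ∪｛ b ｝) ⊢ a
weaken = ⊢-mono (λ _ → inj₁)

assumption : (T ∪｛ a ｝) ⊢ a
assumption = hyp (inj₂ refl)

⇒-refl : T ⊢ (a ⇒ a)
⇒-refl {a = a} = mp (mp (axS a (a ⇒ a) a) (axK a (a ⇒ a))) (axK a a)

⇒-const : T ⊢ a → T ⊢ (b ⇒ a)
⇒-const {a = a} {b} d = mp (axK a b) d

⇒-mp : T ⊢ (c ⇒ a ⇒ b) → T ⊢ (c ⇒ a) → T ⊢ (c ⇒ b)
⇒-mp {c = c} {a} {b} d e = mp (mp (axS c a b) d) e

deduction : (T ∪｛ a ｝) ⊢ b → T ⊢ (a ⇒ b)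
deduction (hyp (inj₁ x))    = ⇒-const (hyp x)
deduction (hyp (inj₂ refl)) = ⇒-refl
deduction (axK a b)         = ⇒-const (axK a b)
deduction (axS a b c)       = ⇒-const (axS a b c)
deduction (ax∧I a b)        = ⇒-const (ax∧I a b)
deduction (ax∧E₁ a b)       = ⇒-const (ax∧E₁ a b)
deduction (ax∧E₂ a b)       = ⇒-const (ax∧E₂ a b)
deduction (ax∨I₁ a b)       = ⇒-const (ax∨I₁ a b)
deduction (ax∨I₂ a b)       = ⇒-const (ax∨I₂ a b)
deduction (ax∨E a b c)      = ⇒-const (ax∨E a b c)
deduction (ax⊥ a)           = ⇒-const (ax⊥ a)
deduction (axSU p q r s)    = ⇒-const (axSU p q r s)
deduction (mp d e)          = ⇒-mp (deduction d) (deduction e)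

⇒-trans : T ⊢ (a ⇒ b) → T ⊢ (b ⇒ c) → T ⊢ (a ⇒ c)
⇒-trans d e = deduction (mp (weaken e) (mp (weaken d) assumption))

contraposition : T ⊢ (a ⇒ b) → T ⊢ (~ b ⇒ ~ a)
contraposition d = deduction (⇒-trans (weaken d) assumption)

∧-intro : T ⊢ a → T ⊢ b → T ⊢ (a ∧ b)
∧-intro {a = a} {b} d e = mp (mp (ax∧I a b) d) e

∧-elimˡ : T ⊢ (a ∧ b) → T ⊢ a
∧-elimˡ {a = a} {b} d = mp (ax∧E₁ a b) d

∧-elimʳ : T ⊢ (a ∧ b) → T ⊢ b
∧-elimʳ {a = a} {b} d = mp (ax∧E₂ a b) d

∨-introˡ : T ⊢ a → T ⊢ (a ∨ b)
∨-introˡ {a = a} {b} d = mp (ax∨I₁ a b) d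

∨-introʳ : T ⊢ b → T ⊢ (a ∨ b)
∨-introʳ {b = b} {a = a} d = mp (ax∨I₂ a b) d

∨-elim : T ⊢ (a ⇒ c) → T ⊢ (b ⇒ c) → T ⊢ (a ∨ b) → T ⊢ c
∨-elim {a = a} {c} {b} d e f = mp (mp (mp (ax∨E a b c) d) e) f

∨-map : ∀ {a' b'} → T ⊢ (a ⇒ a') → T ⊢ (b ⇒ b') → T ⊢ (a ∨ b ⇒ a' ∨ b')
∨-map {a' = a'} {b'} d e = deduction (∨-elim
  (⇒-trans (weaken d) (ax∨I₁ a' b')) (⇒-trans (weaken e) (ax∨I₂ a' b')) assumption)

⊤-intro : T ⊢ ⊤f
⊤-intro = ax⊥ ⊥f

closed-mp : Closed T → T (a ⇒ b) → T a → T b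
closed-mp T-closed a⇒b∈T a∈T = T-closed _ (mp (hyp a⇒b∈T) (hyp a∈T))

closed-∧ : Closed T → T a → T b → T (a ∧ b)
closed-∧ T-closed a∈T b∈T = T-closed _ (∧-intro (hyp a∈T) (hyp b∈T))

closed-⊤ : Closed T → T ⊤f
closed-⊤ T-closed = T-closed _ ⊤-intro

Cross : Formula → Formula → Formula
Cross a b = (~ a ⇒ b) ∧ (~ b ⇒ a)

Cross-mono : ∀ {a' b'} → T ⊢ (a ⇒ a') → T ⊢ (b ⇒ b') → T ⊢ (Cross a b ⇒ Cross a' b')
Cross-mono a⇒a' b⇒b' = deduction (∧-intro
  (⇒-trans (contraposition (weaken a⇒a')) (⇒-trans (∧-elimˡ assumption) (weaken b⇒b')))
  (⇒-trans (contraposition (weaken b⇒b')) (⇒-trans (∧-elimʳ assumption) (weaken a⇒a'))))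

Splits : FSet → FSet → FSet → Set
Splits Γ Δ T = ∀ r s → T ⊢ (r ∨ s) → Γ r ⊎ Δ s

CrossDerivable : FSet → FSet → FSet → Formula → Set
CrossDerivable Φ Γ Δ c = Σ Formula λ α → Σ Formula λ β → Γ α × Δ β × Φ ⊢ (Cross α β ⇒ c)

module _ {Φ Γ Δ : FSet} (Γ-closed : Closed Γ) (Δ-closed : Closed Δ) where

  Φ-⊢⇒CrossDerivable : Φ ⊢ c → CrossDerivable Φ Γ Δ c
  Φ-⊢⇒CrossDerivable d = ⊤f , ⊤f , closed-⊤ Γ-closed , closed-⊤ Δ-closed , ⇒-const d

  ThetaSet-⊢⇒CrossDerivable : ThetaSet Φ Γ Δ ⊢ c → CrossDerivable Φ Γ Δ c
  ThetaSet-⊢⇒CrossDerivable (hyp (inj₁ x)) = Φ-⊢⇒CrossDerivable (hyp x)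
  ThetaSet-⊢⇒CrossDerivable (hyp (inj₂ (inj₁ (α , β , α∈Γ , β∈Δ , refl)))) = α , β , α∈Γ , β∈Δ , ax∧E₁ _ _
  ThetaSet-⊢⇒CrossDerivable (hyp (inj₂ (inj₂ (β , α , β∈Δ , α∈Γ , refl)))) = α , β , α∈Γ , β∈Δ , ax∧E₂ _ _
  ThetaSet-⊢⇒CrossDerivable (axK a b)      = Φ-⊢⇒CrossDerivable (axK a b)
  ThetaSet-⊢⇒CrossDerivable (axS a b c)    = Φ-⊢⇒CrossDerivable (axS a b c)
  ThetaSet-⊢⇒CrossDerivable (ax∧I a b)     = Φ-⊢⇒CrossDerivable (ax∧I a b)
  ThetaSet-⊢⇒CrossDerivable (ax∧E₁ a b)    = Φ-⊢⇒CrossDerivable (ax∧E₁ a b)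
  ThetaSet-⊢⇒CrossDerivable (ax∧E₂ a b)    = Φ-⊢⇒CrossDerivable (ax∧E₂ a b)
  ThetaSet-⊢⇒CrossDerivable (ax∨I₁ a b)    = Φ-⊢⇒CrossDerivable (ax∨I₁ a b)
  ThetaSet-⊢⇒CrossDerivable (ax∨I₂ a b)    = Φ-⊢⇒CrossDerivable (ax∨I₂ a b)
  ThetaSet-⊢⇒CrossDerivable (ax∨E a b c)   = Φ-⊢⇒CrossDerivable (ax∨E a b c)
  ThetaSet-⊢⇒CrossDerivable (ax⊥ a)        = Φ-⊢⇒CrossDerivable (ax⊥ a)
  ThetaSet-⊢⇒CrossDerivable (axSU p q r s) = Φ-⊢⇒CrossDerivable (axSU p q r s)
  ThetaSet-⊢⇒CrossDerivable (mp d e) with ThetaSet-⊢⇒CrossDerivable d | ThetaSet-⊢⇒CrossDerivable e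
  ... | α₁ , β₁ , α₁∈Γ , β₁∈Δ , d' | α₂ , β₂ , α₂∈Γ , β₂∈Δ , e' =
    α₁ ∧ α₂ , β₁ ∧ β₂ , closed-∧ Γ-closed α₁∈Γ α₂∈Γ , closed-∧ Δ-closed β₁∈Δ β₂∈Δ ,
    ⇒-mp (⇒-trans (Cross-mono (ax∧E₁ α₁ α₂) (ax∧E₁ β₁ β₂)) d')
         (⇒-trans (Cross-mono (ax∧E₂ α₁ α₂) (ax∧E₂ β₁ β₂)) e')

  ThetaSet-splits : Closed Φ → DisjComplete Φ → Φ ⊆ (Γ ∩ Δ) → Splits Γ Δ (ThetaSet Φ Γ Δ)
  ThetaSet-splits Φ-closed Φ-complete Φ⊆Γ∩Δ r s d
    with α , β , α∈Γ , β∈Δ , Cross⇒r∨s ← ThetaSet-⊢⇒CrossDerivable d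
    with Φ-complete _ _ (Φ-closed _ (mp (axSU α β r s) Cross⇒r∨s))
  ... | inj₁ α⇒r∈Φ = inj₁ (closed-mp Γ-closed (proj₁ (Φ⊆Γ∩Δ _ α⇒r∈Φ)) α∈Γ)
  ... | inj₂ β⇒s∈Φ = inj₂ (closed-mp Δ-closed (proj₂ (Φ⊆Γ∩Δ _ β⇒s∈Φ)) β∈Δ)

splits⇒⊆∩ : ∀ {Γ Δ} → Consistent Γ → Consistent Δ → Splits Γ Δ T → T ⊆ (Γ ∩ Δ)
splits⇒⊆∩ Γ-consistent Δ-consistent T-splits c c∈T
  with T-splits c ⊥f (∨-introˡ (hyp c∈T)) | T-splits ⊥f c (∨-introʳ (hyp c∈T))
... | inj₂ ⊥∈Δ | _         = ⊥-elim (Δ-consistent (hyp ⊥∈Δ))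
... | _        | inj₁ ⊥∈Γ  = ⊥-elim (Γ-consistent (hyp ⊥∈Γ))
... | inj₁ c∈Γ | inj₂ c∈Δ  = c∈Γ , c∈Δ

module _ {Γ Δ : FSet} (Γ-complete : DisjComplete Γ) (Δ-complete : DisjComplete Δ) where

  splits-either-child : ∀ {r' s'} → Splits Γ Δ T → T ⊢ (a₀ ∨ a₁) →
    (T ∪｛ a₀ ｝) ⊢ (r ∨ s) → (T ∪｛ a₁ ｝) ⊢ (r' ∨ s') → (Γ r ⊎ Δ s) ⊎ (Γ r' ⊎ Δ s')
  splits-either-child {r = r} {s} {r'} {s'} T-splits a₀∨a₁ d₀ d₁
    with T-splits (r ∨ r') (s ∨ s') (∨-elim
           (⇒-trans (deduction d₀) (∨-map (ax∨I₁ r r') (ax∨I₁ s s')))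
           (⇒-trans (deduction d₁) (∨-map (ax∨I₂ r r') (ax∨I₂ s s')))
           a₀∨a₁)
  ... | inj₁ r∨r'∈Γ = [ inj₁ ∘ inj₁ , inj₂ ∘ inj₁ ] (Γ-complete r r' r∨r'∈Γ)
  ... | inj₂ s∨s'∈Δ = [ inj₁ ∘ inj₂ , inj₂ ∘ inj₂ ] (Δ-complete s s' s∨s'∈Δ)

  splitting-child : ExcludedMiddle 0ℓ → Splits Γ Δ T → T ⊢ (a₀ ∨ a₁) →
    Σ Bool λ b → Splits Γ Δ (T ∪｛ Bsel b a₀ a₁ ｝)
  splitting-child {T} {a₀} em T-splits a₀∨a₁ with em {Splits Γ Δ (T ∪｛ a₀ ｝)}
  ... | yes left-splits = false , left-splits
  ... | no ¬left-splits = true , λ r' s' d₁ → dne λ ¬right → ¬left-splits λ r s d₀ → dne λ ¬left →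
          [ ¬left , ¬right ] (splits-either-child T-splits a₀∨a₁ d₀ d₁)
    where dne = em⇒dne em

Least : Pred ℕ 0ℓ → Pred ℕ 0ℓ
Least P n = P n × (∀ m → m < n → ¬ P m)

module _ {P : Pred ℕ 0ℓ} (P? : Decidable P) where

  least-or-none-below : ∀ k → Σ ℕ (Least P) ⊎ (∀ m → m < k → ¬ P m)
  least-or-none-below zero = inj₂ λ _ ()
  least-or-none-below (suc k) with least-or-none-below k
  ... | inj₁ least = inj₁ least
  ... | inj₂ none with P? k
  ...   | yes Pk = inj₁ (k , Pk , none)
  ...   | no ¬Pk = inj₂ λ m m<1+k → [ none m , (λ { refl → ¬Pk }) ] (m<1+n⇒m<n∨m≡n m<1+k)

  least-witness : ∀ {k} → P k → Σ ℕ (Least P)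
  least-witness {k} Pk with least-or-none-below (suc k)
  ... | inj₁ least = least
  ... | inj₂ none  = ⊥-elim (none k (n<1+n k) Pk)

varIndex : Formula → ℕ
varIndex (var k) = k
varIndex _       = 0

rightVarBound : (ℕ → Formula × Formula) → ℕ → ℕ
rightVarBound ξ zero    = 0
rightVarBound ξ (suc N) = rightVarBound ξ N ⊔ suc (varIndex (proj₂ (ξ N)))

rightVarBound-> : ∀ ξ {m N} → m < N → varIndex (proj₂ (ξ m)) < rightVarBound ξ N
rightVarBound-> ξ {m} {suc N} m<1+N with m<1+n⇒m<n∨m≡n m<1+N
... | inj₁ m<N  = m<n⇒m<n⊔o _ (rightVarBound-> ξ m<N)
... | inj₂ refl = m<n⇒m<o⊔n (rightVarBound ξ N) (n<1+n _)

rightVarBound-index : ∀ {ξ m N} → ξ m ≡ (a , var (rightVarBound ξ N)) → N ≤ m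
rightVarBound-index {ξ = ξ} {N = N} ξm≡ = ≮⇒≥ λ m<N →
  <-irrefl refl (subst (λ p → varIndex (proj₂ p) < rightVarBound ξ N) ξm≡ (rightVarBound-> ξ m<N))

-- The witness is ⊤ ∨ p for a variable p that is no right disjunct of ξ 0, …, ξ (N - 1).
derivable-beyond : ∀ {ξ} → Surjective _≡_ _≡_ ξ → ∀ N → Σ ℕ λ m → N ≤ m × T ⊢ Disj ξ m
derivable-beyond {T} {ξ} ξ-onto N with m , ξ-at-m ← ξ-onto (⊤f , var (rightVarBound ξ N)) =
  m , rightVarBound-index (ξ-at-m refl) ,
  subst (λ p → T ⊢ uncurry _∨_ p) (sym (ξ-at-m refl)) (∨-introˡ ⊤-intro)

Cofinite : Pred ℕ 0ℓ → Set
Cofinite A = Σ ℕ λ N → ∀ m → N ≤ m → A m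

Cofinite-remove : ∀ {A} → Cofinite A → ∀ n → Cofinite (λ m → A m × m ≢ n)
Cofinite-remove (N , A-beyond) n = N ⊔ suc n , λ m N⊔1+n≤m →
  A-beyond m (≤-trans (m≤m⊔n N _) N⊔1+n≤m) ,
  λ { refl → <-irrefl refl (≤-trans (m≤n⊔m N _) N⊔1+n≤m) }

module _ (em : ExcludedMiddle 0ℓ) {ξ : ℕ → Formula × Formula} (ξ-onto : Surjective _≡_ _≡_ ξ)
  (Θ : FSet) (Good : FSet → Set)
  (good-child : ∀ {T a₀ a₁} → Good T → T ⊢ (a₀ ∨ a₁) → Σ Bool λ b → Good (T ∪｛ Bsel b a₀ a₁ ｝))
  (Θ-good : Good Θ) where

  record GoodNode (s : List Bool) : Set₁ where
    field
      nodeData : NodeData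
      isNode   : Node ξ Θ s nodeData
      good     : Good (Th nodeData)
      cofinite : Cofinite (Av nodeData)

  Selectable : NodeData → Pred ℕ 0ℓ
  Selectable d m = Av d m × Th d ⊢ Disj ξ m

  selectable-exists : ∀ d → Cofinite (Av d) → Σ ℕ (Selectable d)
  selectable-exists d (N , A-beyond) with m , N≤m , derivable ← derivable-beyond ξ-onto N =
    m , A-beyond m N≤m , derivable

  grow : ∀ {s} → GoodNode s → Σ Bool λ b → GoodNode (s ∷ʳ b)
  grow record { nodeData = d ; isNode = d-node ; good = d-good ; cofinite = d-cofinite }
    with n , (n-available , n-derivable) , n-least
           ← least-witness {Selectable d} (λ _ → em) (proj₂ (selectable-exists d d-cofinite))
    with side , side-good ← good-child d-good n-derivable
    = side , record
      { isNode   = step n d-node n-available n-derivable (λ m m<n → curry (n-least m m<n)) refl side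
      ; good     = side-good
      ; cofinite = Cofinite-remove d-cofinite n
      }

  root-good : GoodNode []
  root-good = record { isNode = root ; good = Θ-good ; cofinite = 0 , λ _ _ → tt }

  goodNodes : ℕ → Σ (List Bool) GoodNode
  goodNodes zero    = [] , root-good
  goodNodes (suc n) = let s , g = goodNodes n in s ∷ʳ proj₁ (grow g) , proj₂ (grow g)

  branch : ℕ → Bool
  branch n = proj₁ (grow (proj₂ (goodNodes n)))

  goodNodes-path : ∀ n → proj₁ (goodNodes n) ≡ prefix branch n
  goodNodes-path zero    = refl
  goodNodes-path (suc n) = cong (_∷ʳ branch n) (goodNodes-path n)

  good-branch : Σ (ℕ → Bool) λ f → ∀ n → Σ NodeData λ d → Node ξ Θ (prefix f n) d × Good (Th d)
  good-branch = branch , λ n → let open GoodNode (proj₂ (goodNodes n)) in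
    nodeData , subst (λ s → Node ξ Θ s nodeData) (goodNodes-path n) isNode , good

corollary2 : ExcludedMiddle 0ℓ →
    (ξ : ℕ → Formula × Formula) → Bijective _≡_ _≡_ ξ →
    (Φ Γ Δ : FSet) → InW Φ → InW Γ → InW Δ → Φ ⊆ (Γ ∩ Δ) →
    Σ (ℕ → Bool) (λ f → ∀ n → Σ NodeData (λ d →
      Node ξ (ThetaSet Φ Γ Δ) (prefix f n) d × Th d ⊆ (Γ ∩ Δ)))
corollary2 em ξ (_ , ξ-onto) Φ Γ Δ (_ , Φ-closed , Φ-complete)
  (Γ-consistent , Γ-closed , Γ-complete) (Δ-consistent , Δ-closed , Δ-complete) Φ⊆Γ∩Δ
  with f , along-f ← good-branch em ξ-onto (ThetaSet Φ Γ Δ) (Splits Γ Δ)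
         (splitting-child Γ-complete Δ-complete em)
         (ThetaSet-splits Γ-closed Δ-closed Φ-closed Φ-complete Φ⊆Γ∩Δ)
  = f , λ n → let d , d-node , d-splits = along-f n in
      d , d-node , splits⇒⊆∩ Γ-consistent Δ-consistent d-splits
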